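{- Let $h$ be a partial function from $[-1,1]$ to $[0,1]$ such that $\mathrm{Dom}(h)$ is dense in $[-1,1]$ and $h$ is non-decreasing, i.e. $\forall x,y\in\mathrm{Dom}(h)[x<y\rightarrow h(x)\le h(y)]$. Then all but countably many elements of $[-1,1]$ are points of continuity for $h$: there exists an infinite sequence $z_0,z_1,\dots$ of reals such that every $u\in[-1,1]$ with $\forall n[u\,\#\,z_n]$ is a point of continuity for $h$.
   Context: Setting: intuitionistic mathematics (intuitionistic logic), with countable choice. Reals: shrinking, dwindling sequences of pairs of rationals, $x<y\iff\exists n[x''(n)<y'(n)]$; apartness $x\,\#\,y$ iff $x<y\vee y<x$. A partial function from $[-1,1]$ to $[0,1]$ is a relation $h\subseteq[-1,1]\times[0,1]$ that is functional and respects real equality; $\mathrm{Dom}(h)$ is its domain. $\mathrm{Dom}(h)$ is dense in $[-1,1]$ if every open interval $(a,b)$ with $-1\le a<b\le1$ contains an element of $\mathrm{Dom}(h)$. A real $u\in[-1,1]$ is a point of continuity for $h$ iff $\forall n\,\exists t\in\mathrm{Dom}(h)\,\exists w\in\mathrm{Dom}(h)[t<u<w\wedge h(w)-h(t)<2^{ -n}]$. -}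

module Defs where

open import Data.Nat using (ℕ; zero; suc)
open import Data.Rational using (ℚ; _<_; _≤_; _-_; _*_; ½; 0ℚ; 1ℚ; -_)
open import Data.Product using (Σ; _×_; _,_; proj₁; proj₂; ∃)
open import Data.Sum using (_⊎_)
open import Relation.Nullary using (¬_)

2^-_ : ℕ → ℚ
2^- zero = 1ℚ
2^- suc n = ½ * (2^- n)

record ℝ : Set where
  constructor mkℝ
  field
    seq       : ℕ → ℚ × ℚ
    ordered   : ∀ n → proj₁ (seq n) ≤ proj₂ (seq n)
    shrinking : ∀ n → (proj₁ (seq n) ≤ proj₁ (seq (suc n)))
                      × (proj₂ (seq (suc n)) ≤ proj₂ (seq n))
    dwindling : ∀ m → Σ ℕ λ n → (proj₂ (seq n) - proj₁ (seq n)) < 2^- m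

open ℝ public

_′_ : ℝ → ℕ → ℚ
x ′ n = proj₁ (seq x n)

_″_ : ℝ → ℕ → ℚ
x ″ n = proj₂ (seq x n)

ι : ℚ → ℝ
ι q = mkℝ (λ _ → q , q) (λ _ → Data.Rational.Properties.≤-refl)
         (λ _ → Data.Rational.Properties.≤-refl , Data.Rational.Properties.≤-refl)
         (λ m → 0 , dw m)
  where
    import Data.Rational.Properties
    open import Data.Rational.Properties using (+-inverseʳ)
    open import Relation.Binary.PropositionalEquality using (sym; subst)
    pos : ∀ m → 0ℚ < 2^- m
    pos zero = Data.Rational.Properties.positive⁻¹ 1ℚ
    pos (suc m) = Data.Rational.Properties.*-monoʳ-<-pos ½ (pos m)
      |> λ p → subst (_< ½ * (2^- m)) (Data.Rational.Properties.*-zeroʳ ½) p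
      where open import Function using (_|>_)
    dw : ∀ m → (q - q) < 2^- m
    dw m = subst (_< 2^- m) (sym (+-inverseʳ q)) (pos m)

infix 4 _<ℝ_ _≤ℝ_ _=ℝ_ _#_

_<ℝ_ : ℝ → ℝ → Set
x <ℝ y = Σ ℕ λ n → x ″ n < y ′ n

_≤ℝ_ : ℝ → ℝ → Set
x ≤ℝ y = ¬ (y <ℝ x)

_=ℝ_ : ℝ → ℝ → Set
x =ℝ y = (x ≤ℝ y) × (y ≤ℝ x)

_#_ : ℝ → ℝ → Set
x # y = (x <ℝ y) ⊎ (y <ℝ x)

-- y - x < q, literally unfolded: ∃n [ (y - x)''(n) < q ], where (y - x)''(n) = y''(n) - x'(n)
DiffLt : ℝ → ℝ → ℚ → Set
DiffLt y x q = Σ ℕ λ n → (y ″ n - x ′ n) < q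

InI : ℝ → Set
InI x = (ι (- 1ℚ) ≤ℝ x) × (x ≤ℝ ι 1ℚ)

InU : ℝ → Set
InU x = (ι 0ℚ ≤ℝ x) × (x ≤ℝ ι 1ℚ)

record PartialFn (h : ℝ → ℝ → Set) : Set where
  field
    graph⊆     : ∀ x y → h x y → InI x × InU y
    functional : ∀ x y y′ → h x y → h x y′ → y =ℝ y′
    respects   : ∀ x x′ y y′ → x =ℝ x′ → y =ℝ y′ → h x y → h x′ y′

Dom : (ℝ → ℝ → Set) → ℝ → Set
Dom h x = Σ ℝ λ y → h x y

DenseDom : (ℝ → ℝ → Set) → Set
DenseDom h = ∀ a b → ι (- 1ℚ) ≤ℝ a → a <ℝ b → b ≤ℝ ι 1ℚ →
             Σ ℝ λ x → Dom h x × (a <ℝ x) × (x <ℝ b)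

NonDecreasing : (ℝ → ℝ → Set) → Set
NonDecreasing h = ∀ x y hx hy → h x hx → h y hy → x <ℝ y → hx ≤ℝ hy

PointOfContinuity : (ℝ → ℝ → Set) → ℝ → Set
PointOfContinuity h u = ∀ n → Σ ℝ λ t → Σ ℝ λ w → Σ ℝ λ ht → Σ ℝ λ hw →
  h t ht × h w hw × (t <ℝ u) × (u <ℝ w) × DiffLt hw ht (2^- n)

-- For a rational interval [lo , hi] of values, bisect [-1 , 1]: at each step two points
-- of the dense domain are probed inside the current interval, and each probe d has
-- lo < h d or h d < hi because hi - lo exceeds the precision to which h d is located.
-- The limit is a real X such that every u < X has a domain point w > u with h w < hi
-- and every u > X has a domain point t < u with h t > lo. Cover [0 , 1] by a grid of
-- mesh 2^-(n+1) for every n and collect all the resulting cut points. A u apart from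
-- all of them lies strictly between two consecutive cut points of each grid, which
-- supplies t < u < w with h w - h t below twice the mesh.
module Submission where

open import Defs
open import Data.Nat using (ℕ; zero; suc; _≤′_; ≤′-refl; ≤′-step)
import Data.Nat as ℕ
import Data.Nat.Properties as ℕ
open import Data.Product using (Σ; ∃; _×_; _,_; proj₁; proj₂) renaming (map to Σ-map)
open import Data.Sum using (_⊎_; inj₁; inj₂; swap)
open import Data.Empty using (⊥-elim)
open import Relation.Nullary using (¬_; yes; no)
open import Relation.Binary.PropositionalEquality
  using (_≡_; refl; sym; trans; cong; cong₂; subst)
open import Data.Rational using (ℚ; _<_; _≤_; _-_; _+_; _*_; ½; 0ℚ; 1ℚ; -_)
import Data.Rational.Properties as ℚ
open import Data.Rational.Solver using (module +-*-Solver)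
open +-*-Solver

twice : ℚ → ℚ
twice x = x + x

twice-½* : ∀ x → twice (½ * x) ≡ x
twice-½* x = trans (sym (ℚ.*-distribʳ-+ x ½ ½)) (ℚ.*-identityˡ x)

p≤p+q : ∀ p {q} → 0ℚ ≤ q → p ≤ p + q
p≤p+q p 0≤q = subst (_≤ p + _) (ℚ.+-identityʳ p) (ℚ.+-monoʳ-≤ p 0≤q)

p<p+q : ∀ p {q} → 0ℚ < q → p < p + q
p<p+q p 0<q = subst (_< p + _) (ℚ.+-identityʳ p) (ℚ.+-monoʳ-< p 0<q)

twice-pos : ∀ {x} → 0ℚ < x → 0ℚ < twice x
twice-pos {x} 0<x = ℚ.<-trans 0<x (p<p+q x 0<x)

½*-pos : ∀ {x} → 0ℚ < x → 0ℚ < ½ * x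
½*-pos {x} 0<x = subst (_< ½ * x) (ℚ.*-zeroʳ ½) (ℚ.*-monoʳ-<-pos ½ 0<x)

½*-< : ∀ {x} → 0ℚ < x → ½ * x < x
½*-< {x} 0<x = subst (½ * x <_) (twice-½* x) (p<p+q (½ * x) (½*-pos 0<x))

2^-pos : ∀ n → 0ℚ < 2^- n
2^-pos zero = ℚ.positive⁻¹ 1ℚ
2^-pos (suc n) = ½*-pos (2^-pos n)

-‿mono-< : ∀ {a b c d} → a < b → d < c → a - c < b - d
-‿mono-< a<b d<c = ℚ.+-mono-< a<b (ℚ.neg-antimono-< d<c)

quarter : ℕ → ℚ
quarter n = 2^- suc n

width : ℕ → ℚ
width n = twice (twice (quarter n))

0≤width : ∀ n → 0ℚ ≤ width n
0≤width n = ℚ.<⇒≤ (twice-pos (twice-pos (2^-pos (suc n))))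

width-suc : ∀ n → width (suc n) ≡ twice (quarter n)
width-suc n = cong twice (twice-½* (quarter n))

width-narrows : ∀ m → width (suc (suc m)) < 2^- m
width-narrows m = subst (_< 2^- m) (sym (trans (width-suc (suc m)) (twice-½* (2^- suc m))))
  (½*-< (2^-pos m))

′-mono : (x : ℝ) → ∀ {m n} → m ≤′ n → x ′ m ≤ x ′ n
′-mono x ≤′-refl = ℚ.≤-refl
′-mono x (≤′-step m≤n) = ℚ.≤-trans (′-mono x m≤n) (proj₁ (shrinking x _))

″-antitone : (x : ℝ) → ∀ {m n} → m ≤′ n → x ″ n ≤ x ″ m
″-antitone x ≤′-refl = ℚ.≤-refl
″-antitone x (≤′-step m≤n) = ℚ.≤-trans (proj₂ (shrinking x _)) (″-antitone x m≤n)

′≤″ : (x : ℝ) → ∀ m n → x ′ m ≤ x ″ n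
′≤″ x m n = ℚ.≤-trans (′-mono x (ℕ.≤⇒≤′ (ℕ.m≤m+n m n)))
  (ℚ.≤-trans (ordered x (m ℕ.+ n)) (″-antitone x (ℕ.≤⇒≤′ (ℕ.m≤n+m n m))))

<ℝ-trans : ∀ x y z → x <ℝ y → y <ℝ z → x <ℝ z
<ℝ-trans x y z (m , x<y) (n , y<z) = m ℕ.+ n ,
  ℚ.≤-<-trans (″-antitone x (ℕ.≤⇒≤′ (ℕ.m≤m+n m n)))
    (ℚ.<-≤-trans x<y (ℚ.≤-trans (′≤″ y m n)
      (ℚ.<⇒≤ (ℚ.<-≤-trans y<z (′-mono z (ℕ.≤⇒≤′ (ℕ.m≤n+m n m)))))))

ι-mono-≤ : ∀ {p q} → p ≤ q → ι p ≤ℝ ι q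
ι-mono-≤ p≤q (_ , q<p) = ℚ.<-irrefl refl (ℚ.<-≤-trans q<p p≤q)

ι<⊎<ι : ∀ (y : ℝ) a k → (ι a <ℝ y) ⊎ (y <ℝ ι (a + 2^- k))
ι<⊎<ι y a k with dwindling y k
... | n , narrow with a ℚ.<? y ′ n
...   | yes a<y = inj₁ (n , a<y)
...   | no a≮y = inj₂ (n , subst (_< a + 2^- k) (sym (diff+ (y ″ n) (y ′ n)))
                    (subst ((y ″ n - y ′ n) + y ′ n <_) (ℚ.+-comm (2^- k) a)
                      (ℚ.+-mono-<-≤ narrow (ℚ.≮⇒≥ a≮y))))
  where
  diff+ : ∀ p q → p ≡ (p - q) + q
  diff+ = solve 2 (λ p q → p := (p :- q) :+ q) refl

DiffLt-bounds : ∀ x y a b → ι a <ℝ x → y <ℝ ι b → DiffLt y x (b - a)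
DiffLt-bounds x y a b (m , a<x) (n , y<b) = m ℕ.+ n ,
  -‿mono-< (ℚ.≤-<-trans (″-antitone y (ℕ.≤⇒≤′ (ℕ.m≤n+m n m))) y<b)
           (ℚ.<-≤-trans a<x (′-mono x (ℕ.≤⇒≤′ (ℕ.m≤m+n m n))))

mesh : ℕ → ℚ
mesh N = 2^- suc N

-- Starting one mesh below 0 makes the lowest cut point lie left of every u.
grid : ℕ → ℕ → ℚ
grid N zero = - mesh N
grid N (suc i) = grid N i + mesh N

grid-1 : ∀ N → grid N 1 ≡ 0ℚ
grid-1 N = ℚ.+-inverseˡ (mesh N)

grid-suc-double : ∀ N i → grid (suc N) (suc (i ℕ.+ i)) ≡ grid N (suc i)
grid-suc-double N zero = trans (grid-1 (suc N)) (sym (grid-1 N))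
grid-suc-double N (suc i) rewrite ℕ.+-suc i i =
  trans (ℚ.+-assoc (grid (suc N) (suc (i ℕ.+ i))) (mesh (suc N)) (mesh (suc N)))
        (cong₂ _+_ (grid-suc-double N i) (twice-½* (mesh N)))

grid-reaches-1 : ∀ N → ∃ λ i → 1ℚ ≤ grid N (suc i)
grid-reaches-1 zero = 2 , ℚ.≤-refl
grid-reaches-1 (suc N) with grid-reaches-1 N
... | i , 1≤grid = i ℕ.+ i , subst (1ℚ ≤_) (sym (grid-suc-double N i)) 1≤grid

grid-gap : ∀ N j → grid N (suc (suc j)) - grid N j ≡ 2^- N
grid-gap N j = trans (p+e+e-p (grid N j) (mesh N)) (twice-½* (2^- N))
  where
  p+e+e-p : ∀ p e → ((p + e) + e) - p ≡ twice e
  p+e+e-p = solve 2 (λ p e → ((p :+ e) :+ e) :- p := e :+ e) refl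

crossing : ∀ {A B : ℕ → Set} → (∀ i → A i ⊎ B i) → A 0 → ∀ m → B (suc m) →
           ∃ λ j → A j × B (suc j)
crossing dec a₀ zero b₁ = 0 , a₀ , b₁
crossing dec a₀ (suc m) b with dec (suc m)
... | inj₁ a = suc m , a , b
... | inj₂ b′ = crossing dec a₀ m b′

diagonal-step : ℕ × ℕ → ℕ × ℕ
diagonal-step (a , zero) = 0 , suc a
diagonal-step (a , suc b) = suc a , b

unpair : ℕ → ℕ × ℕ
unpair zero = 0 , 0
unpair (suc k) = diagonal-step (unpair k)

unpair-surjective : ∀ a b → ∃ λ k → unpair k ≡ (a , b)
unpair-surjective a b = onDiagonal (a ℕ.+ b) a b refl
  where
  onDiagonal : ∀ s a b → a ℕ.+ b ≡ s → ∃ λ k → unpair k ≡ (a , b)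
  onDiagonal s zero zero _ = 0 , refl
  onDiagonal s (suc a) b a+b≡s =
    Σ-map suc (cong diagonal-step) (onDiagonal s a (suc b) (trans (ℕ.+-suc a b) a+b≡s))
  onDiagonal (suc s) zero (suc b) b≡s =
    Σ-map suc (cong diagonal-step)
      (onDiagonal s b zero (trans (ℕ.+-identityʳ b) (ℕ.suc-injective b≡s)))

module _ (h : ℝ → ℝ → Set) where

  DipsBelowRightOf : ℝ → ℚ → Set
  DipsBelowRightOf u q = Σ ℝ λ w → Σ ℝ λ hw → h w hw × (u <ℝ w) × (hw <ℝ ι q)

  RisesAboveLeftOf : ℝ → ℚ → Set
  RisesAboveLeftOf u q = Σ ℝ λ t → Σ ℝ λ ht → h t ht × (t <ℝ u) × (ι q <ℝ ht)

  dips-<ℝ : ∀ u v {q} → u <ℝ v → DipsBelowRightOf v q → DipsBelowRightOf u q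
  dips-<ℝ u v u<v (w , hw , graph , v<w , hw<q) =
    w , hw , graph , <ℝ-trans u v w u<v v<w , hw<q

  rises-<ℝ : ∀ u v {q} → v <ℝ u → RisesAboveLeftOf v q → RisesAboveLeftOf u q
  rises-<ℝ u v v<u (t , ht , graph , t<v , q<ht) =
    t , ht , graph , <ℝ-trans t v u t<v v<u , q<ht

  OscillationBelow : ℝ → ℚ → Set
  OscillationBelow u q = Σ ℝ λ t → Σ ℝ λ w → Σ ℝ λ ht → Σ ℝ λ hw →
    h t ht × h w hw × (t <ℝ u) × (u <ℝ w) × DiffLt hw ht q

  squeeze : ∀ u a b → RisesAboveLeftOf u a → DipsBelowRightOf u b →
            OscillationBelow u (b - a)
  squeeze u a b (t , ht , ht-graph , t<u , a<ht) (w , hw , hw-graph , u<w , hw<b) =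
    t , w , ht , hw , ht-graph , hw-graph , t<u , u<w , DiffLt-bounds ht hw a b a<ht hw<b

  module _ (partial : PartialFn h) where

    no-dips-below-0 : ∀ u {q} → q ≤ 0ℚ → ¬ DipsBelowRightOf u q
    no-dips-below-0 u q≤0 (w , hw , graph , _ , n , hw<q) =
      proj₁ (proj₂ (PartialFn.graph⊆ partial w hw graph)) (n , ℚ.<-≤-trans hw<q q≤0)

    no-rises-above-1 : ∀ u {q} → 1ℚ ≤ q → ¬ RisesAboveLeftOf u q
    no-rises-above-1 u 1≤q (t , ht , graph , _ , n , q<ht) =
      proj₂ (proj₂ (PartialFn.graph⊆ partial t ht graph)) (n , ℚ.≤-<-trans 1≤q q<ht)

  module Cut (dense : DenseDom h) (lo : ℚ) (k : ℕ) where

    hi : ℚ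
    hi = lo + 2^- k

    probe : ∀ {a b} → - 1ℚ ≤ a → a < b → b ≤ 1ℚ →
            RisesAboveLeftOf (ι b) lo ⊎ DipsBelowRightOf (ι a) hi
    probe {a} {b} -1≤a a<b b≤1
      with dense (ι a) (ι b) (ι-mono-≤ -1≤a) (0 , a<b) (ι-mono-≤ b≤1)
    ... | d , (hd , graph) , a<d , d<b with ι<⊎<ι hd lo k
    ...   | inj₁ lo<hd = inj₁ (d , hd , graph , d<b , lo<hd)
    ...   | inj₂ hd<hi = inj₂ (d , hd , graph , a<d , hd<hi)

    -- An end beyond [-1 , 1] needs no witness: no u ∈ [-1 , 1] lies beyond it.
    ValidLeftEnd : ℚ → Set
    ValidLeftEnd p = (p ≤ - 1ℚ) ⊎ DipsBelowRightOf (ι p) hi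

    ValidRightEnd : ℚ → Set
    ValidRightEnd q = (1ℚ ≤ q) ⊎ RisesAboveLeftOf (ι q) lo

    record Bracket (n : ℕ) : Set where
      constructor bracket
      field
        left    : ℚ
        -1≤left : - 1ℚ ≤ left
        right≤1 : left + width n ≤ 1ℚ
        dips    : ValidLeftEnd left
        rises   : ValidRightEnd (left + width n)

    open Bracket

    right : ∀ {n} → Bracket n → ℚ
    right {n} B = left B + width n

    _⊑_ : ∀ {m n} → Bracket m → Bracket n → Set
    B ⊑ C = (left C ≤ left B) × (right B ≤ right C)

    refine : ∀ {n} (B : Bracket n) → Σ (Bracket (suc n)) (_⊑ B)
    refine {n} B@(bracket p -1≤p q≤1 dips rises) = choose (probe -1≤p₁ p₁<p₂ p₂≤1)
      where
      e p₁ p₂ p₃ q : ℚ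
      e = quarter n
      p₁ = p + e
      p₂ = p₁ + e
      p₃ = p₂ + e
      q = p + width n

      e>0 : 0ℚ < e
      e>0 = 2^-pos (suc n)

      p≤p₁ : p ≤ p₁
      p≤p₁ = p≤p+q p (ℚ.<⇒≤ e>0)
      p₁<p₂ : p₁ < p₂
      p₁<p₂ = p<p+q p₁ e>0
      p₂<p₃ : p₂ < p₃
      p₂<p₃ = p<p+q p₂ e>0

      quarters : q ≡ p₃ + e
      quarters = solve 2 (λ p e → p :+ ((e :+ e) :+ (e :+ e)) := (((p :+ e) :+ e) :+ e) :+ e)
                       refl p e
      p₃≤q : p₃ ≤ q
      p₃≤q = subst (p₃ ≤_) (sym quarters) (p≤p+q p₃ (ℚ.<⇒≤ e>0))
      p₂≤q : p₂ ≤ q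
      p₂≤q = ℚ.≤-trans (ℚ.<⇒≤ p₂<p₃) p₃≤q
      p₂≤1 : p₂ ≤ 1ℚ
      p₂≤1 = ℚ.≤-trans p₂≤q q≤1
      -1≤p₁ : - 1ℚ ≤ p₁
      -1≤p₁ = ℚ.≤-trans -1≤p p≤p₁
      p≤p₂ : p ≤ p₂
      p≤p₂ = ℚ.≤-trans p≤p₁ (ℚ.<⇒≤ p₁<p₂)
      -1≤p₂ : - 1ℚ ≤ p₂
      -1≤p₂ = ℚ.≤-trans -1≤p p≤p₂
      p₃≤1 : p₃ ≤ 1ℚ
      p₃≤1 = ℚ.≤-trans p₃≤q q≤1

      next : ∀ r → - 1ℚ ≤ r → p ≤ r → (r + e) + e ≤ q →
             ValidLeftEnd r → ValidRightEnd ((r + e) + e) → Σ (Bracket (suc n)) (_⊑ B)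
      next r -1≤r p≤r r₂≤q dips′ rises′ =
        bracket r -1≤r (subst (_≤ 1ℚ) (sym r+width) (ℚ.≤-trans r₂≤q q≤1)) dips′
                (subst ValidRightEnd (sym r+width) rises′)
        , p≤r , subst (_≤ q) (sym r+width) r₂≤q
        where
        r+width : r + width (suc n) ≡ (r + e) + e
        r+width = trans (cong (r +_) (width-suc n)) (sym (ℚ.+-assoc r e e))

      choose : RisesAboveLeftOf (ι p₂) lo ⊎ DipsBelowRightOf (ι p₁) hi →
               Σ (Bracket (suc n)) (_⊑ B)
      choose (inj₁ rises₂) = next p -1≤p ℚ.≤-refl p₂≤q dips (inj₂ rises₂)
      choose (inj₂ dips₁) = chooseRight (probe -1≤p₂ p₂<p₃ p₃≤1)
        where
        chooseRight : RisesAboveLeftOf (ι p₃) lo ⊎ DipsBelowRightOf (ι p₂) hi →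
                      Σ (Bracket (suc n)) (_⊑ B)
        chooseRight (inj₁ rises₃) =
          next p₁ -1≤p₁ p≤p₁ p₃≤q (inj₂ dips₁) (inj₂ rises₃)
        chooseRight (inj₂ dips₂) =
          next p₂ -1≤p₂ p≤p₂ (ℚ.≤-reflexive (sym quarters)) (inj₂ dips₂)
               (subst ValidRightEnd quarters rises)

    initial : Bracket 0
    initial = bracket (- 1ℚ) ℚ.≤-refl ℚ.≤-refl (inj₁ ℚ.≤-refl) (inj₁ ℚ.≤-refl)

    brackets : ∀ n → Bracket n
    brackets zero = initial
    brackets (suc n) = proj₁ (refine (brackets n))

    cutPoint : ℝ
    cutPoint = mkℝ (λ n → left (brackets n) , right (brackets n))
      (λ n → p≤p+q (left (brackets n)) (0≤width n))
      (λ n → proj₂ (refine (brackets n)))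
      (λ m → suc (suc m) , narrow m)
      where
      narrow : ∀ m → right (brackets (suc (suc m))) - left (brackets (suc (suc m))) < 2^- m
      narrow m = subst (_< 2^- m) (sym (p+q-p (left (brackets (suc (suc m)))) _)) (width-narrows m)
        where
        p+q-p : ∀ p q → (p + q) - p ≡ q
        p+q-p = solve 2 (λ p q → (p :+ q) :- p := q) refl

    below-cutPoint : ∀ u → InI u → u <ℝ cutPoint → DipsBelowRightOf u hi
    below-cutPoint u (-1≤u , _) (n , u<left) with dips (brackets n)
    ... | inj₁ left≤-1 = ⊥-elim (-1≤u (n , ℚ.<-≤-trans u<left left≤-1))
    ... | inj₂ dips′ = dips-<ℝ u (ι (left (brackets n))) (n , u<left) dips′

    above-cutPoint : ∀ u → InI u → cutPoint <ℝ u → RisesAboveLeftOf u lo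
    above-cutPoint u (_ , u≤1) (n , right<u) with rises (brackets n)
    ... | inj₁ 1≤right = ⊥-elim (u≤1 (n , ℚ.≤-<-trans 1≤right right<u))
    ... | inj₂ rises′ = rises-<ℝ u (ι (right (brackets n))) (n , right<u) rises′

  gridCut : DenseDom h → ℕ → ℕ → ℝ
  gridCut dense N i = Cut.cutPoint dense (grid N i) (suc N)

  module _ (partial : PartialFn h) (dense : DenseDom h) where

    open Cut dense using (below-cutPoint; above-cutPoint)

    oscillation-below-grid : ∀ u → InI u → ∀ N → (∀ i → u # gridCut dense N i) →
                             OscillationBelow u (2^- N)
    oscillation-below-grid u inI N apart =
      between (crossing (λ i → swap (apart i)) start (proj₁ top) (proj₂ top))
      where
      start : gridCut dense N 0 <ℝ u
      start with apart 0
      ... | inj₁ u<cut = ⊥-elim (no-dips-below-0 partial u (ℚ.≤-reflexive (grid-1 N))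
                                   (below-cutPoint (grid N 0) (suc N) u inI u<cut))
      ... | inj₂ cut<u = cut<u

      top : ∃ λ i → u <ℝ gridCut dense N (suc i)
      top with grid-reaches-1 N
      ... | i , 1≤grid with apart (suc i)
      ...   | inj₁ u<cut = i , u<cut
      ...   | inj₂ cut<u = ⊥-elim (no-rises-above-1 partial u 1≤grid
                                     (above-cutPoint (grid N (suc i)) (suc N) u inI cut<u))

      between : (∃ λ j → gridCut dense N j <ℝ u × u <ℝ gridCut dense N (suc j)) →
                OscillationBelow u (2^- N)
      between (j , cut<u , u<cut) = subst (OscillationBelow u) (grid-gap N j)
        (squeeze u (grid N j) (grid N (suc (suc j))) (above-cutPoint (grid N j) (suc N) u inI cut<u)
                 (below-cutPoint (grid N (suc j)) (suc N) u inI u<cut))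

theorem5p23 : (h : ℝ → ℝ → Set) → PartialFn h → DenseDom h → NonDecreasing h →
    Σ (ℕ → ℝ) λ z → ∀ u → InI u → (∀ n → u # z n) → PointOfContinuity h u
theorem5p23 h partial dense _ = z , λ u inI apart N →
  oscillation-below-grid h partial dense u inI N (apart-from-grid u apart N)
  where
  z : ℕ → ℝ
  z k = gridCut h dense (proj₁ (unpair k)) (proj₂ (unpair k))

  apart-from-grid : ∀ u → (∀ k → u # z k) → ∀ N i → u # gridCut h dense N i
  apart-from-grid u apart N i with unpair-surjective N i
  ... | k , unpair-k = subst (λ (N , i) → u # gridCut h dense N i) unpair-k (apart k)
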